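{- In $\mathsf{AEM}_{\mathsf{pl}}$ extended by the definitions $x\prec aa\leftrightarrow Ax$, $y\prec\mathfrak{at}_x\leftrightarrow Pyx\land y\prec aa$, and $y\prec\mathfrak{at}_{xx}\leftrightarrow\exists z(z\prec xx\land Pyz\land y\prec aa)$, the formula $F_{\mathfrak{at}_{zz}}x\to F_{zz}x$ is provable.
   Context: Language: two-sorted classical logic with individual variables $x,y,z,\dots$ and plural variables $xx,yy,zz,\dots$; identity $=$ between individuals; the predicate $x\prec tt$ ("$x$ is one of $tt$"), individual on the left, plural term on the right. Abbreviations: $\forall_{z\prec tt}\varphi:=\forall z(z\prec tt\to\varphi)$, $\exists_{z\prec tt}\varphi:=\exists z(z\prec tt\land\varphi)$. The only non-logical primitive is a binary predicate $P$ on individuals ("is a part of"); $Oxy:=\exists z(Pzx\land Pzy)$. $\mathsf{AEM}_{\mathsf{pl}}$ has axioms (universally closed): $Pxx$; $Pxy\land Pyz\to Pxz$; $Pxy\land Pyx\to x=y$; $\neg Pxy\to\exists z(Pzx\land\neg Ozy)$; the definitions $Ax\leftrightarrow\forall y(Pyx\to x=y)$ and $F_{tt}x\leftrightarrow \forall_{z\prec tt}Pzx\land\forall y(Pyx\to\exists_{z\prec tt}Ozy)$ for plural terms $tt$ (mereological sum); and the atomicity axiom $\forall x\exists y(Pyx\land Ay)$. -}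

module Defs where

open import Data.Product using (Σ; ∃; _×_; _,_)
open import Relation.Nullary using (¬_)
open import Relation.Binary.PropositionalEquality using (_≡_)
open import Function.Bundles using (_⇔_)

-- A (Henkin-style) model of the language: individuals, pluralities,
-- the membership predicate _≺_ ("is one of") and the parthood predicate P.
record Language : Set₁ where
  field
    Ind    : Set
    Plural : Set
    _≺_    : Ind → Plural → Set
    P      : Ind → Ind → Set

module Notions (L : Language) where
  open Language L

  O : Ind → Ind → Set
  O x y = ∃ λ z → P z x × P z y

  A : Ind → Set
  A x = ∀ y → P y x → x ≡ y

  F : Plural → Ind → Set
  F tt x = (∀ z → z ≺ tt → P z x) × (∀ y → P y x → ∃ λ z → z ≺ tt × O z y)

-- A model of AEM_pl extended by the definitions of aa, at_x and at_xx
-- (the defined plural terms are interpreted by the fields aa, at₁, atₚ,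
-- subject to their defining biconditionals).
record AEMplModel : Set₁ where
  field
    L : Language
  open Language L public
  open Notions L public
  field
    P-refl    : ∀ x → P x x
    P-trans   : ∀ x y z → P x y → P y z → P x z
    P-antisym : ∀ x y → P x y → P y x → x ≡ y
    supplementation : ∀ x y → ¬ P x y → ∃ λ z → P z x × ¬ O z y
    atomicity : ∀ x → ∃ λ y → P y x × A y
    aa    : Plural
    aa-def : ∀ x → (x ≺ aa) ⇔ A x
    at₁   : Ind → Plural
    at₁-def : ∀ x y → (y ≺ at₁ x) ⇔ (P y x × y ≺ aa)
    atₚ   : Plural → Plural
    atₚ-def : ∀ xx y → (y ≺ atₚ xx) ⇔ (∃ λ z → z ≺ xx × P y z × y ≺ aa)

-- Every member z of zz is part of x: otherwise supplementation gives a part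
-- of z disjoint from x, and an atom below it is one of the atoms of zz,
-- hence part of x — a contradiction. Conversely, every part of x overlaps
-- an atom of zz, and that atom lies below a member of zz.
module Submission where

open import Defs
open import Level using (0ℓ)
open import Axiom.ExcludedMiddle using (ExcludedMiddle)
open import Data.Product using (∃; _×_; _,_)
open import Relation.Nullary using (yes; no)
open import Data.Empty using (⊥-elim)
open import Function.Bundles using (Equivalence)

module _ (M : AEMplModel) where
  open AEMplModel M

  O-monoˡ : ∀ {z w y} → P z w → O z y → O w y
  O-monoˡ {z} {w} zw (u , uz , uy) = u , P-trans u z w uz zw , uy

  atₚ-below-member : ∀ {zz y} → y ≺ atₚ zz → ∃ λ z → z ≺ zz × P y z
  atₚ-below-member {zz} {y} y∈ with Equivalence.to (atₚ-def zz y) y∈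
  ... | z , z∈ , yz , _ = z , z∈ , yz

  atom-below-member-∈-atₚ : ∀ {zz z a} → z ≺ zz → P a z → A a → a ≺ atₚ zz
  atom-below-member-∈-atₚ {zz} {z} {a} z∈ az atom-a =
    Equivalence.from (atₚ-def zz a) (z , z∈ , az , Equivalence.from (aa-def a) atom-a)

  part-if-atoms-part : ExcludedMiddle 0ℓ → ∀ z x →
    (∀ a → P a z → A a → P a x) → P z x
  part-if-atoms-part em z x atoms-part with em {P z x}
  ... | yes zx = zx
  ... | no ¬zx with supplementation z x ¬zx
  ... | w , wz , ¬Owx with atomicity w
  ... | a , aw , atom-a =
    ⊥-elim (¬Owx (a , aw , atoms-part a (P-trans a w z aw wz) atom-a))

lemma7 : ExcludedMiddle 0ℓ → (M : AEMplModel) →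
    let open AEMplModel M in
    ∀ (zz : Plural) (x : Ind) → F (atₚ zz) x → F zz x
lemma7 em M zz x (atoms-part , atoms-overlap) = members-part , parts-overlap
  where
  open AEMplModel M

  members-part : ∀ z → z ≺ zz → P z x
  members-part z z∈ = part-if-atoms-part M em z x λ a az atom-a →
    atoms-part a (atom-below-member-∈-atₚ M z∈ az atom-a)

  parts-overlap : ∀ y → P y x → ∃ λ z → z ≺ zz × O z y
  parts-overlap y yx with atoms-overlap y yx
  ... | a , a∈ , Oay with atₚ-below-member M a∈
  ... | z , z∈ , az = z , z∈ , O-monoˡ M az Oay
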